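{- Let $\Sigma$ be a finite alphabet of numbers with $\sigma=|\Sigma|$. Let $P_1', \dots, P_k'$ be $k$ strings of length $m$ over $\Sigma$ and let $1 \le b \le m$, $b \le \sigma$, be such that every substring of length $b$ of every $P_i'$ has pairwise distinct characters. For a block $x$ (a string of length $b$ over $\Sigma$), define $l_x = \max\{ j : b \le j \le m,\ \exists i \in \{1,\dots,k\} \text{ with } Pre(P_i'[j-b+1..j]) = Pre(x) \}$, with $l_x = -\infty$ if no such $j$ exists, and define the shift value of $x$ as $\min(m - l_x,\ m-b+1)$. Let $x$ be chosen uniformly at random among the ${}_\sigma P_b=\sigma!/(\sigma-b)!$ strings of length $b$ over $\Sigma$ with pairwise distinct characters. Then the expected shift value of $x$ is at least $(m-b+1)\left\{1 - \frac{k(m-b+2)}{2\, b!}\right\}$.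
   Context: For a string $z$ and a character $c$, $rank_z(c) = 1 + |\{ i : z[i] < c,\ 1 \le i \le |z| \}|$. With $z_i = z[1..i]$ the prefix of length $i$, the prefix representation is $Pre(z) = (rank_{z_1}(z[1]), \dots, rank_{z_{|z|}}(z[|z|]))$. The notation $z[a..c]$ denotes the substring $(z[a], z[a+1], \dots, z[c])$. -}

module Defs where

open import Data.Nat as ℕ using (ℕ; zero; suc; _+_; _*_; _∸_; _≤_; _<_; _!; _⊔_; _⊓_)
open import Data.Nat.Properties using (_≟_; _<?_; m*n≢0; _!≢0)
open import Data.Fin using (Fin; toℕ)
open import Data.Fin.Properties as FinP using ()
open import Data.List using (List; []; _∷_; _++_; [_]; map; filter; length; take; drop; upTo; allFin; concatMap; foldr)
open import Data.Nat.ListAction using (sum)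
open import Data.List.Relation.Unary.Any using (any?)
open import Data.List.Properties using (≡-dec)
open import Data.List.Relation.Unary.Unique.Propositional using (Unique)
import Data.List.Relation.Unary.Unique.DecPropositional as UDec
open import Relation.Nullary using (yes; no)
open import Data.Maybe using (Maybe; just; nothing; maybe)
open import Data.Integer using (+_)
open import Data.Rational as ℚ using (ℚ; _/_; 0ℚ; 1ℚ)

Str : ℕ → Set
Str σ = List (Fin σ)

countLess : {σ : ℕ} → Fin σ → Str σ → ℕ
countLess c [] = 0
countLess c (a ∷ as) with toℕ a <? toℕ c
... | yes _ = suc (countLess c as)
... | no _ = countLess c as

rank : {σ : ℕ} → Str σ → Fin σ → ℕ
rank z c = suc (countLess c z)

-- Pre(z) = (rank_{z_1}(z[1]), ..., rank_{z_|z|}(z[|z|])); acc is the prefix read so far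
preGo : {σ : ℕ} → Str σ → Str σ → List ℕ
preGo acc [] = []
preGo acc (c ∷ cs) = rank (acc ++ [ c ]) c ∷ preGo (acc ++ [ c ]) cs

Pre : {σ : ℕ} → Str σ → List ℕ
Pre z = preGo [] z

-- z[a..c] (1-indexed, inclusive) = take (c - a + 1) (drop (a - 1) z)
substr : {σ : ℕ} → Str σ → ℕ → ℕ → Str σ
substr z a c = take (suc c ∸ a) (drop (a ∸ 1) z)

range : ℕ → ℕ → List ℕ
range b m = map (λ t → b + t) (upTo (suc m ∸ b))

allStrings : (σ n : ℕ) → List (Str σ)
allStrings σ zero = [] ∷ []
allStrings σ (suc n) = concatMap (λ c → map (c ∷_) (allStrings σ n)) (allFin σ)

distinctStrings : (σ b : ℕ) → List (Str σ)
distinctStrings σ b = filter (UDec.unique? (FinP._≟_ {σ})) (allStrings σ b)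

maxList : List ℕ → Maybe ℕ
maxList [] = nothing
maxList (j ∷ js) = just (maybe (j ⊔_) j (maxList js))

-- l_x = max { j : b ≤ j ≤ m, ∃ i, Pre(P_i[j-b+1..j]) = Pre(x) }, nothing = -∞
lx : {σ : ℕ} (k m b : ℕ) → (Fin k → Str σ) → Str σ → Maybe ℕ
lx k m b P x =
  maxList (filter (λ j → any? (λ i → ≡-dec _≟_ (Pre (substr (P i) (suc j ∸ b) j)) (Pre x)) (allFin k))
                  (range b m))

-- shift value min(m - l_x, m - b + 1), with m - (-∞) = +∞
shift : {σ : ℕ} (k m b : ℕ) → (Fin k → Str σ) → Str σ → ℕ
shift k m b P x = maybe (λ l → (m ∸ l) ⊓ (suc (m ∸ b))) (suc (m ∸ b)) (lx k m b P x)

-- average of a list of naturals, as a rational (0 for the empty list)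
average : List ℕ → ℚ
average xs with length xs
... | zero = 0ℚ
... | suc n = (+ sum xs) / suc n

expectedShift : (σ k m b : ℕ) → (Fin k → Str σ) → ℚ
expectedShift σ k m b P = average (map (shift k m b P) (distinctStrings σ b))

bound : (k m b : ℕ) → ℚ
bound k m b =
  ((+ suc (m ∸ b)) / 1) ℚ.* (1ℚ ℚ.- _/_ (+ (k * (suc (suc (m ∸ b))))) (2 * b !) {{m*n≢0 2 (b !) {{_}} {{b !≢0}}}})

-- Write M = m - b + 1 and give the window P_i[j-b+1..j] the weight j - b + 1.  If l_x = l, the
-- window ending at l has the pattern of x, and the shift of x is m - l = M - (weight of that
-- window); so shift(x) ≥ M minus the total weight of the windows with the pattern of x.  Summed
-- over the N distinct strings x, each window is counted once per string with its pattern, and a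
-- pattern is shared by at most N / b! of them.  The weights of the windows of one P_i add up to
-- M (M + 1) / 2, so the shifts add up to at least N M - k N M (M + 1) / (2 b!).
--
-- The N / b! bound is proved by induction on σ.  A distinct string over σ + 1 letters either avoids
-- the largest letter, or arises from a distinct string y of length b - 1 by inserting that letter
-- at some position p < b; its pattern is then the pattern of y with the rank p + 1 inserted at p,
-- and p can be read off from it.

module Submission where

open import Defs

open import Data.Bool using (true; false; if_then_else_)
open import Data.Empty using (⊥-elim)
open import Data.Fin using (Fin; toℕ; fromℕ; inject₁)
open import Data.Fin.Properties using (toℕ<n; toℕ-inject₁; toℕ-fromℕ; inject₁-injective; fromℕ≢inject₁)
  renaming (_≟_ to _≟ᶠ_)
open import Data.Fin.Relation.Unary.Top using (view; ‵fromℕ; ‵inject₁)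
open import Data.Integer as ℤ using (ℤ)
import Data.Integer.Properties as ℤₚ
open import Data.Integer.Tactic.RingSolver using () renaming (solve-∀ to solve-∀ℤ)
open import Data.List
  using (List; []; _∷_; _++_; [_]; map; length; filter; upTo; take; allFin; concatMap; cartesianProductWith)
open import Data.List.Properties
  using (∷-injective; ∷-injectiveˡ; ∷-injectiveʳ; ≡-dec; length-map; length-++; length-take; length-tabulate;
         length-filter; map-injective; map-∘; map-cong; map-++; upTo-∷ʳ;
         filter-all; filter-none; filter-accept; filter-reject; filter-++)
open import Data.List.Membership.Propositional using (_∈_; _∉_; find)
open import Data.List.Membership.Propositional.Properties
  using (∈-++⁻; ∈-++⁺ˡ; ∈-++⁺ʳ; ∈-map⁻; ∈-map⁺; ∈-filter⁺; ∈-filter⁻; ∈-allFin; ∈-upTo⁻; ∈-length;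
         ∈-cartesianProductWith⁺; ∈-cartesianProductWith⁻)
open import Data.List.Membership.Propositional.Properties.WithK using (unique∧set⇒bag)
open import Data.List.Relation.Binary.BagAndSetEquality using (∼bag⇒↭)
open import Data.List.Relation.Binary.Disjoint.Propositional using (Disjoint)
open import Data.List.Relation.Binary.Permutation.Propositional using (_↭_)
open import Data.List.Relation.Binary.Permutation.Propositional.Properties using (filter-↭; ↭-length)
open import Data.List.Relation.Unary.All as All using (All; []; _∷_)
open import Data.List.Relation.Unary.All.Properties using (¬Any⇒All¬)
open import Data.List.Relation.Unary.Any using (here; there; any?; satisfied)
open import Data.List.Relation.Unary.Any.Properties using (map⁻)
open import Data.List.Relation.Unary.Unique.DecPropositional using (unique?)
open import Data.List.Relation.Unary.Unique.Propositional using (Unique; []; _∷_)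
import Data.List.Relation.Unary.Unique.Propositional.Properties as Uniqueₚ
open import Data.Maybe using (just; nothing)
open import Data.Nat as ℕ using (ℕ; zero; suc; _+_; _*_; _∸_; _≤_; _<_; z≤n; s≤s; _!; _⊓_; NonZero)
open import Data.Nat.ListAction using (sum)
open import Data.Nat.ListAction.Properties using (sum-++)
open import Data.Nat.Properties
open import Algebra.Properties.CommutativeSemigroup +-commutativeSemigroup using (interchange)
open import Algebra.Properties.CommutativeSemigroup *-commutativeSemigroup using (x∙yz≈y∙xz)
open import Data.Nat.Tactic.RingSolver using (solve-∀)
open import Data.Product using (_×_; _,_; proj₁; proj₂; ∃; ∃₂)
open import Data.Rational as ℚ using (_/_; 1ℚ; toℚᵘ; _≥_)
import Data.Rational.Properties as ℚₚ
import Data.Rational.Unnormalised as ℚᵘ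
import Data.Rational.Unnormalised.Properties as ℚᵘₚ
open import Data.Sum as Sum using (_⊎_; inj₁; inj₂)
open import Data.Unit using (⊤; tt)
open import Function using (_∘_; id)
open import Function.Bundles using (mk⇔)
open import Relation.Binary using (tri<; tri≈; tri>)
open import Relation.Binary.PropositionalEquality hiding ([_])
open import Relation.Nullary using (does; yes; no; ¬_)
open import Relation.Nullary.Decidable using (dec-true)
open import Relation.Unary using (Decidable)

-- Sums over lists

module _ {A : Set} where

  sum-map-+ : (f g : A → ℕ) (xs : List A) →
    sum (map (λ x → f x + g x) xs) ≡ sum (map f xs) + sum (map g xs)
  sum-map-+ f g [] = refl
  sum-map-+ f g (x ∷ xs) =
    trans (cong (f x + g x +_) (sum-map-+ f g xs)) (interchange (f x) (g x) _ _)

  sum-map-const : (c : ℕ) (xs : List A) → sum (map (λ _ → c) xs) ≡ length xs * c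
  sum-map-const c [] = refl
  sum-map-const c (x ∷ xs) = cong (c +_) (sum-map-const c xs)

  sum-map-*ˡ : (c : ℕ) (f : A → ℕ) (xs : List A) → sum (map (λ x → c * f x) xs) ≡ c * sum (map f xs)
  sum-map-*ˡ c f [] = sym (*-zeroʳ c)
  sum-map-*ˡ c f (x ∷ xs) = trans (cong (c * f x +_) (sum-map-*ˡ c f xs)) (sym (*-distribˡ-+ c (f x) _))

  sum-map-mono : {f g : A → ℕ} (xs : List A) → (∀ x → f x ≤ g x) → sum (map f xs) ≤ sum (map g xs)
  sum-map-mono [] f≤g = z≤n
  sum-map-mono (x ∷ xs) f≤g = +-mono-≤ (f≤g x) (sum-map-mono xs f≤g)

  ∈⇒≤sum-map : (f : A → ℕ) {x : A} {xs : List A} → x ∈ xs → f x ≤ sum (map f xs)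
  ∈⇒≤sum-map f {xs = y ∷ ys} (here refl) = m≤m+n (f y) _
  ∈⇒≤sum-map f {xs = y ∷ ys} (there x∈ys) = ≤-trans (∈⇒≤sum-map f x∈ys) (m≤n+m _ (f y))

  sum-map-if : {P : A → Set} (P? : Decidable P) (w : ℕ) (xs : List A) →
    sum (map (λ x → if does (P? x) then w else 0) xs) ≡ w * length (filter P? xs)
  sum-map-if P? w [] = sym (*-zeroʳ w)
  sum-map-if P? w (x ∷ xs) with does (P? x)
  ... | true = trans (cong (w +_) (sum-map-if P? w xs)) (sym (*-suc w _))
  ... | false = sum-map-if P? w xs

module _ {A B : Set} where

  sum-map-comm : (g : A → B → ℕ) (xs : List A) (ys : List B) →
    sum (map (λ x → sum (map (g x) ys)) xs) ≡ sum (map (λ y → sum (map (λ x → g x y) xs)) ys)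
  sum-map-comm g [] ys = sym (trans (sum-map-const 0 ys) (*-zeroʳ (length ys)))
  sum-map-comm g (x ∷ xs) ys = trans (cong (sum (map (g x) ys) +_) (sum-map-comm g xs ys))
    (sym (sum-map-+ (g x) (λ y → sum (map (λ x′ → g x′ y) xs)) ys))

2*sum-upTo-suc : (n : ℕ) → 2 * sum (map suc (upTo n)) ≡ n * suc n
2*sum-upTo-suc zero = refl
2*sum-upTo-suc (suc n) = begin
  2 * sum (map suc (upTo (suc n)))        ≡⟨ cong (λ t → 2 * sum (map suc t)) (sym (upTo-∷ʳ n)) ⟩
  2 * sum (map suc (upTo n ++ [ n ]))     ≡⟨ cong (λ t → 2 * sum t) (map-++ suc (upTo n) [ n ]) ⟩
  2 * sum (map suc (upTo n) ++ [ suc n ]) ≡⟨ cong (2 *_) (sum-++ (map suc (upTo n)) [ suc n ]) ⟩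
  2 * (sum (map suc (upTo n)) + (suc n + 0)) ≡⟨ *-distribˡ-+ 2 (sum (map suc (upTo n))) _ ⟩
  2 * sum (map suc (upTo n)) + 2 * (suc n + 0) ≡⟨ cong (_+ 2 * (suc n + 0)) (2*sum-upTo-suc n) ⟩
  n * suc n + 2 * (suc n + 0)             ≡⟨ expand n ⟩
  suc n * suc (suc n)                     ∎
  where
  open ≡-Reasoning
  expand : ∀ n → n * suc n + 2 * (suc n + 0) ≡ suc n * suc (suc n)
  expand = solve-∀

-- Insertion at a position

insert : {A : Set} → ℕ → A → List A → List A
insert zero v xs = v ∷ xs
insert (suc p) v [] = v ∷ []
insert (suc p) v (x ∷ xs) = x ∷ insert p v xs

module _ {A : Set} where

  length-insert : ∀ p (v : A) xs → length (insert p v xs) ≡ suc (length xs)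
  length-insert zero v xs = refl
  length-insert (suc p) v [] = refl
  length-insert (suc p) v (x ∷ xs) = cong suc (length-insert p v xs)

  ∈-insert : ∀ p (v : A) xs → v ∈ insert p v xs
  ∈-insert zero v xs = here refl
  ∈-insert (suc p) v [] = here refl
  ∈-insert (suc p) v (x ∷ xs) = there (∈-insert p v xs)

  ∈-insert⁺ : ∀ p (v : A) {z} xs → z ∈ xs → z ∈ insert p v xs
  ∈-insert⁺ zero v xs z∈xs = there z∈xs
  ∈-insert⁺ (suc p) v (x ∷ xs) (here z≡x) = here z≡x
  ∈-insert⁺ (suc p) v (x ∷ xs) (there z∈xs) = there (∈-insert⁺ p v xs z∈xs)

  ∈-insert⁻ : ∀ p (v : A) {z} xs → z ∈ insert p v xs → z ≡ v ⊎ z ∈ xs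
  ∈-insert⁻ zero v xs (here z≡v) = inj₁ z≡v
  ∈-insert⁻ zero v xs (there z∈xs) = inj₂ z∈xs
  ∈-insert⁻ (suc p) v [] (here z≡v) = inj₁ z≡v
  ∈-insert⁻ (suc p) v (x ∷ xs) (here z≡x) = inj₂ (here z≡x)
  ∈-insert⁻ (suc p) v (x ∷ xs) (there z∈) = Sum.map₂ there (∈-insert⁻ p v xs z∈)

  insert≢[] : ∀ p (v : A) xs → insert p v xs ≢ []
  insert≢[] zero v xs ()
  insert≢[] (suc p) v [] ()
  insert≢[] (suc p) v (x ∷ xs) ()

  insert-injective : ∀ p (v : A) {xs ys} → insert p v xs ≡ insert p v ys → xs ≡ ys
  insert-injective zero v eq = ∷-injectiveʳ eq
  insert-injective (suc p) v {[]} {[]} eq = refl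
  insert-injective (suc p) v {[]} {y ∷ ys} eq = ⊥-elim (insert≢[] p v ys (sym (∷-injectiveʳ eq)))
  insert-injective (suc p) v {x ∷ xs} {[]} eq = ⊥-elim (insert≢[] p v xs (∷-injectiveʳ eq))
  insert-injective (suc p) v {x ∷ xs} {y ∷ ys} eq =
    cong₂ _∷_ (∷-injectiveˡ eq) (insert-injective p v (∷-injectiveʳ eq))

  insert-unique : ∀ p (v : A) {xs} → v ∉ xs → Unique xs → Unique (insert p v xs)
  insert-unique zero v v∉xs xs! = All.tabulate (λ z∈xs v≡z → v∉xs (subst (_∈ _) (sym v≡z) z∈xs)) ∷ xs!
  insert-unique (suc p) v {[]} v∉xs xs! = [] ∷ []
  insert-unique (suc p) v {x ∷ xs} v∉x∷xs (x∉xs ∷ xs!) =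
    All.tabulate x≢ ∷ insert-unique p v (v∉x∷xs ∘ there) xs!
    where
    x≢ : ∀ {z} → z ∈ insert p v xs → x ≢ z
    x≢ z∈ x≡z with ∈-insert⁻ p v xs z∈
    ... | inj₁ z≡v = v∉x∷xs (here (trans (sym z≡v) (sym x≡z)))
    ... | inj₂ z∈xs = All.lookup x∉xs z∈xs x≡z

module _ {A B : Set} (f : A → B) where

  map-insert : ∀ p v xs → map f (insert p v xs) ≡ insert p (f v) (map f xs)
  map-insert zero v xs = refl
  map-insert (suc p) v [] = refl
  map-insert (suc p) v (x ∷ xs) = cong (f x ∷_) (map-insert p v xs)

-- Ranks

below : ℕ → List ℕ → ℕ
below c xs = length (filter (_<? c) xs)

below-++ : ∀ c xs ys → below c (xs ++ ys) ≡ below c xs + below c ys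
below-++ c xs ys = trans (cong length (filter-++ (_<? c) xs ys)) (length-++ (filter (_<? c) xs))

below-∷ʳ : ∀ c x xs → below c (xs ++ [ x ]) ≡ below c (x ∷ xs)
below-∷ʳ c x xs = trans (below-++ c xs [ x ]) (trans (+-comm (below c xs) _) (sym (below-++ c [ x ] xs)))

below-skip : ∀ {c s} u v → ¬ s < c → below c (u ++ s ∷ v) ≡ below c (u ++ v)
below-skip {c} {s} u v s≮c = begin
  below c (u ++ s ∷ v)         ≡⟨ below-++ c u (s ∷ v) ⟩
  below c u + below c (s ∷ v)  ≡⟨ cong (λ t → below c u + length t) (filter-reject (_<? c) s≮c) ⟩
  below c u + below c v        ≡⟨ below-++ c u v ⟨
  below c (u ++ v)             ∎
  where open ≡-Reasoning

ranks : List ℕ → List ℕ → List ℕ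
ranks acc [] = []
ranks acc (c ∷ cs) = suc (below c acc) ∷ ranks (c ∷ acc) cs

ranks-cong : ∀ {s acc acc′ cs} → (∀ {c} → c < s → below c acc ≡ below c acc′) →
  All (_< s) cs → ranks acc cs ≡ ranks acc′ cs
ranks-cong same [] = refl
ranks-cong {s} {acc} {acc′} {c ∷ cs} same (c<s ∷ cs<s) =
  cong₂ _∷_ (cong suc (same c<s)) (ranks-cong same′ cs<s)
  where
  same′ : ∀ {c′} → c′ < s → below c′ (c ∷ acc) ≡ below c′ (c ∷ acc′)
  same′ {c′} c′<s = begin
    below c′ ([ c ] ++ acc)            ≡⟨ below-++ c′ [ c ] acc ⟩
    below c′ [ c ] + below c′ acc      ≡⟨ cong (below c′ [ c ] +_) (same c′<s) ⟩
    below c′ [ c ] + below c′ acc′     ≡⟨ below-++ c′ [ c ] acc′ ⟨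
    below c′ ([ c ] ++ acc′)           ∎
    where open ≡-Reasoning

ranks-insert-max : ∀ {s} p acc cs → All (_< s) acc → All (_< s) cs → p ≤ length cs →
  ranks acc (insert p s cs) ≡ insert p (suc (p + length acc)) (ranks acc cs)
ranks-insert-max {s} zero acc cs acc<s cs<s _ =
  cong₂ _∷_ (cong (suc ∘ length) (filter-all (_<? s) acc<s))
            (ranks-cong (λ {c} c<s → below-skip [] acc (<⇒≯ c<s)) cs<s)
ranks-insert-max {s} (suc p) acc (c ∷ cs) acc<s (c<s ∷ cs<s) (s≤s p≤∣cs∣) =
  cong (suc (below c acc) ∷_)
    (trans (ranks-insert-max p (c ∷ acc) cs (c<s ∷ acc<s) cs<s p≤∣cs∣)
           (cong (λ r → insert p (suc r) (ranks (c ∷ acc) cs)) (+-suc p (length acc))))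

RanksBounded : ℕ → List ℕ → Set
RanksBounded a [] = ⊤
RanksBounded a (r ∷ ρ) = r ≤ suc a × RanksBounded (suc a) ρ

ranks-bounded : ∀ acc cs → RanksBounded (length acc) (ranks acc cs)
ranks-bounded acc [] = tt
ranks-bounded acc (c ∷ cs) = s≤s (length-filter (_<? c) acc) , ranks-bounded (c ∷ acc) cs

insert-ranks-bound : ∀ a q {v} τ → RanksBounded a (insert q v τ) → v ≤ suc (a + q)
insert-ranks-bound a zero {v} τ (v≤1+a , _) = subst (λ t → v ≤ suc t) (sym (+-identityʳ a)) v≤1+a
insert-ranks-bound a (suc q) [] (v≤1+a , _) = ≤-trans v≤1+a (s≤s (m≤m+n a (suc q)))
insert-ranks-bound a (suc q) {v} (r ∷ τ) (_ , τ-bounded) =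
  subst (λ t → v ≤ suc t) (sym (+-suc a q)) (insert-ranks-bound (suc a) q τ τ-bounded)

-- At position q > p the rank a + q + 1 exceeds the bound a + q that the shifted entry of ρ obeys.
insert-max-rank-<⇒≢ : ∀ a p q ρ ρ′ → RanksBounded a ρ → p < q →
  insert p (suc (a + p)) ρ ≢ insert q (suc (a + q)) ρ′
insert-max-rank-<⇒≢ a zero (suc q) ρ [] _ _ eq with +-cancelˡ-≡ a 0 (suc q) (suc-injective (∷-injectiveˡ eq))
... | ()
insert-max-rank-<⇒≢ a zero (suc q) ρ (r′ ∷ τ′) bρ _ eq =
  <-irrefl refl (≤-trans (s≤s (≤-reflexive (sym (+-suc a q))))
    (insert-ranks-bound a q τ′ (subst (RanksBounded a) (∷-injectiveʳ eq) bρ)))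
insert-max-rank-<⇒≢ a (suc p) (suc q) [] [] _ (s≤s p<q) eq =
  <-irrefl (+-cancelˡ-≡ a _ _ (suc-injective (∷-injectiveˡ eq))) (s≤s p<q)
insert-max-rank-<⇒≢ a (suc p) (suc q) [] (r′ ∷ τ′) _ _ eq = insert≢[] q _ τ′ (sym (∷-injectiveʳ eq))
insert-max-rank-<⇒≢ a (suc p) (suc q) (r ∷ τ) [] _ _ eq = insert≢[] p _ τ (∷-injectiveʳ eq)
insert-max-rank-<⇒≢ a (suc p) (suc q) (r ∷ τ) (r′ ∷ τ′) (_ , bτ) (s≤s p<q) eq =
  insert-max-rank-<⇒≢ (suc a) p q τ τ′ bτ p<q
    (subst₂ (λ x y → insert p (suc x) τ ≡ insert q (suc y) τ′) (+-suc a p) (+-suc a q) (∷-injectiveʳ eq))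

insert-max-rank-injective : ∀ a p q ρ ρ′ → RanksBounded a ρ → RanksBounded a ρ′ →
  insert p (suc (a + p)) ρ ≡ insert q (suc (a + q)) ρ′ → p ≡ q
insert-max-rank-injective a p q ρ ρ′ bρ bρ′ eq with <-cmp p q
... | tri< p<q _ _ = ⊥-elim (insert-max-rank-<⇒≢ a p q ρ ρ′ bρ p<q eq)
... | tri≈ _ p≡q _ = p≡q
... | tri> _ _ q<p = ⊥-elim (insert-max-rank-<⇒≢ a q p ρ′ ρ bρ′ q<p (sym eq))

countLess≡below : ∀ {σ} (c : Fin σ) (xs : Str σ) → countLess c xs ≡ below (toℕ c) (map toℕ xs)
countLess≡below c [] = refl
countLess≡below c (a ∷ as) with toℕ a <? toℕ c
... | yes a<c = trans (cong suc (countLess≡below c as)) (sym (cong length (filter-accept (_<? toℕ c) a<c)))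
... | no a≮c = trans (countLess≡below c as) (sym (cong length (filter-reject (_<? toℕ c) a≮c)))

toℕ<-all : ∀ {σ} (xs : Str σ) → All (_< σ) (map toℕ xs)
toℕ<-all [] = []
toℕ<-all (x ∷ xs) = toℕ<n x ∷ toℕ<-all xs

preGo≡ranks : ∀ {σ} (acc cs : Str σ) → preGo acc cs ≡ ranks (map toℕ acc) (map toℕ cs)
preGo≡ranks acc [] = refl
preGo≡ranks {σ} acc (c ∷ cs) = cong₂ _∷_ (cong suc rank≡) (trans (preGo≡ranks (acc ++ [ c ]) cs) ranks≡)
  where
  open ≡-Reasoning
  read : map toℕ (acc ++ [ c ]) ≡ map toℕ acc ++ [ toℕ c ]
  read = map-++ toℕ acc [ c ]
  rank≡ : countLess c (acc ++ [ c ]) ≡ below (toℕ c) (map toℕ acc)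
  rank≡ = begin
    countLess c (acc ++ [ c ])                    ≡⟨ countLess≡below c (acc ++ [ c ]) ⟩
    below (toℕ c) (map toℕ (acc ++ [ c ]))        ≡⟨ cong (below (toℕ c)) read ⟩
    below (toℕ c) (map toℕ acc ++ [ toℕ c ])      ≡⟨ below-∷ʳ (toℕ c) (toℕ c) (map toℕ acc) ⟩
    below (toℕ c) (toℕ c ∷ map toℕ acc)           ≡⟨ cong length (filter-reject (_<? toℕ c) (<-irrefl refl)) ⟩
    below (toℕ c) (map toℕ acc)                   ∎
  ranks≡ : ranks (map toℕ (acc ++ [ c ])) (map toℕ cs) ≡ ranks (toℕ c ∷ map toℕ acc) (map toℕ cs)
  ranks≡ = ranks-cong {s = σ} (λ {c′} _ → trans (cong (below c′) read) (below-∷ʳ c′ (toℕ c) (map toℕ acc)))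
                      (toℕ<-all cs)

Pre≡ranks : ∀ {σ} (z : Str σ) → Pre z ≡ ranks [] (map toℕ z)
Pre≡ranks = preGo≡ranks []

Pre-bounded : ∀ {σ} (z : Str σ) → RanksBounded 0 (Pre z)
Pre-bounded z = subst (RanksBounded 0) (sym (Pre≡ranks z)) (ranks-bounded [] (map toℕ z))

-- Adding a largest letter

lift : ∀ {σ} → Str σ → Str (suc σ)
lift = map inject₁

lift-injective : ∀ {σ} {y y′ : Str σ} → lift y ≡ lift y′ → y ≡ y′
lift-injective = map-injective inject₁-injective

lift-unique : ∀ {σ} {y : Str σ} → Unique y → Unique (lift y)
lift-unique = Uniqueₚ.map⁺ inject₁-injective

fromℕ∉lift : ∀ {σ} (y : Str σ) → fromℕ σ ∉ lift y
fromℕ∉lift (c ∷ y) (here top≡c) = fromℕ≢inject₁ top≡c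
fromℕ∉lift (c ∷ y) (there top∈y) = fromℕ∉lift y top∈y

toℕ-lift : ∀ {σ} (y : Str σ) → map toℕ (lift y) ≡ map toℕ y
toℕ-lift y = trans (sym (map-∘ y)) (map-cong toℕ-inject₁ y)

Pre-lift : ∀ {σ} (y : Str σ) → Pre (lift y) ≡ Pre y
Pre-lift y = trans (Pre≡ranks (lift y)) (trans (cong (ranks []) (toℕ-lift y)) (sym (Pre≡ranks y)))

insertTop : ∀ {σ} → ℕ → Str σ → Str (suc σ)
insertTop {σ} p y = insert p (fromℕ σ) (lift y)

length-insertTop : ∀ {σ} p (y : Str σ) → length (insertTop p y) ≡ suc (length y)
length-insertTop p y = trans (length-insert p _ (lift y)) (cong suc (length-map inject₁ y))

Pre-insertTop : ∀ {σ} p (y : Str σ) → p ≤ length y → Pre (insertTop p y) ≡ insert p (suc p) (Pre y)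
Pre-insertTop {σ} p y p≤∣y∣ = begin
  Pre (insertTop p y)                              ≡⟨ Pre≡ranks _ ⟩
  ranks [] (map toℕ (insert p (fromℕ σ) (lift y))) ≡⟨ cong (ranks []) letters ⟩
  ranks [] (insert p σ (map toℕ y))                ≡⟨ ranks-insert-max p [] (map toℕ y) [] (toℕ<-all y) p≤ ⟩
  insert p (suc (p + 0)) (ranks [] (map toℕ y))    ≡⟨ cong₂ (λ r ρ → insert p (suc r) ρ) (+-identityʳ p)
                                                              (sym (Pre≡ranks y)) ⟩
  insert p (suc p) (Pre y)                         ∎
  where
  open ≡-Reasoning
  letters : map toℕ (insert p (fromℕ σ) (lift y)) ≡ insert p σ (map toℕ y)
  letters = trans (map-insert toℕ p (fromℕ σ) (lift y)) (cong₂ (insert p) (toℕ-fromℕ σ) (toℕ-lift y))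
  p≤ : p ≤ length (map toℕ y)
  p≤ = subst (p ≤_) (sym (length-map toℕ y)) p≤∣y∣

Pre-insertTop-injective : ∀ {σ} {p q} {y y′ : Str σ} → p ≤ length y → q ≤ length y′ →
  Pre (insertTop p y) ≡ Pre (insertTop q y′) → p ≡ q × Pre y ≡ Pre y′
Pre-insertTop-injective {p = p} {q} {y} {y′} p≤ q≤ eq =
  p≡q , insert-injective q (suc q) (subst (λ r → insert r (suc r) (Pre y) ≡ _) p≡q ranks≡)
  where
  ranks≡ : insert p (suc p) (Pre y) ≡ insert q (suc q) (Pre y′)
  ranks≡ = trans (sym (Pre-insertTop p y p≤)) (trans eq (Pre-insertTop q y′ q≤))
  p≡q : p ≡ q
  p≡q = insert-max-rank-injective 0 p q (Pre y) (Pre y′) (Pre-bounded y) (Pre-bounded y′) ranks≡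

topInsertions : ∀ {σ} → List (Str σ) → ℕ → List (Str (suc σ))
topInsertions ys zero = []
topInsertions ys (suc n) = topInsertions ys n ++ map (insertTop n) ys

module _ {σ : ℕ} (ys : List (Str σ)) where

  length-topInsertions : ∀ n → length (topInsertions ys n) ≡ n * length ys
  length-topInsertions zero = refl
  length-topInsertions (suc n) = begin
    length (topInsertions ys n ++ map (insertTop n) ys) ≡⟨ length-++ (topInsertions ys n) ⟩
    length (topInsertions ys n) + length (map (insertTop n) ys) ≡⟨ cong₂ _+_ (length-topInsertions n) (length-map _ ys) ⟩
    n * length ys + length ys                          ≡⟨ +-comm (n * length ys) _ ⟩
    suc n * length ys                                  ∎
    where open ≡-Reasoning

  ∈-topInsertions⁻ : ∀ n {x} → x ∈ topInsertions ys n → ∃₂ λ p y → p < n × y ∈ ys × x ≡ insertTop p y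
  ∈-topInsertions⁻ (suc n) x∈ with ∈-++⁻ (topInsertions ys n) x∈
  ... | inj₁ x∈tn with ∈-topInsertions⁻ n x∈tn
  ...   | p , y , p<n , y∈ys , refl = p , y , m≤n⇒m≤1+n p<n , y∈ys , refl
  ∈-topInsertions⁻ (suc n) x∈ | inj₂ x∈map with ∈-map⁻ (insertTop n) x∈map
  ...   | y , y∈ys , refl = n , y , ≤-refl , y∈ys , refl

  ∈-topInsertions⁺ : ∀ n {p y} → p < n → y ∈ ys → insertTop p y ∈ topInsertions ys n
  ∈-topInsertions⁺ (suc n) {p} p<1+n y∈ys with m≤n⇒m<n∨m≡n (≤-pred p<1+n)
  ... | inj₁ p<n = ∈-++⁺ˡ (∈-topInsertions⁺ n p<n y∈ys)
  ... | inj₂ refl = ∈-++⁺ʳ (topInsertions ys n) (∈-map⁺ (insertTop n) y∈ys)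

  topInsertions-unique : ∀ {b} n → (∀ {y} → y ∈ ys → length y ≡ b) → n ≤ suc b → Unique ys →
    Unique (topInsertions ys n)
  topInsertions-unique zero _ _ _ = []
  topInsertions-unique {b} (suc n) ∣ys∣≡b n<1+b ys! =
    Uniqueₚ.++⁺ (topInsertions-unique n ∣ys∣≡b (m≤n⇒m≤1+n (≤-pred n<1+b)) ys!)
                (Uniqueₚ.map⁺ insertTop-n-injective ys!)
                disjoint
    where
    ≤length : ∀ {p y} → p ≤ n → y ∈ ys → p ≤ length y
    ≤length p≤n y∈ys = subst (_ ≤_) (sym (∣ys∣≡b y∈ys)) (≤-trans p≤n (≤-pred n<1+b))
    insertTop-n-injective : ∀ {y y′} → insertTop n y ≡ insertTop n y′ → y ≡ y′
    insertTop-n-injective = lift-injective ∘ insert-injective n (fromℕ σ)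
    disjoint : Disjoint (topInsertions ys n) (map (insertTop n) ys)
    disjoint (x∈tn , x∈map) with ∈-topInsertions⁻ n x∈tn | ∈-map⁻ (insertTop n) x∈map
    ... | p , y , p<n , y∈ys , refl | y′ , y′∈ys , eq =
      <-irrefl (proj₁ (Pre-insertTop-injective (≤length (<⇒≤ p<n) y∈ys) (≤length ≤-refl y′∈ys) (cong Pre eq))) p<n

liftOrInsertTop : ∀ {σ} (x : Str (suc σ)) → Unique x →
  (∃ λ y → Unique y × x ≡ lift y) ⊎ (∃₂ λ p y → Unique y × p ≤ length y × x ≡ insertTop p y)
liftOrInsertTop [] _ = inj₁ ([] , [] , refl)
liftOrInsertTop (c ∷ x) (c∉x ∷ x!) with view c | liftOrInsertTop x x!
... | ‵fromℕ | inj₁ (y , y! , refl) = inj₂ (0 , y , y! , z≤n , refl)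
... | ‵fromℕ | inj₂ (p , y , _ , _ , refl) = ⊥-elim (All.lookup c∉x (∈-insert p _ (lift y)) refl)
... | ‵inject₁ i | inj₁ (y , y! , refl) =
  inj₁ (i ∷ y , All.tabulate (λ j∈y i≡j → All.lookup c∉x (∈-map⁺ inject₁ j∈y) (cong inject₁ i≡j)) ∷ y! , refl)
... | ‵inject₁ i | inj₂ (p , y , y! , p≤∣y∣ , refl) =
  inj₂ (suc p , i ∷ y ,
        All.tabulate (λ j∈y i≡j → All.lookup c∉x (∈-insert⁺ p _ (lift y) (∈-map⁺ inject₁ j∈y)) (cong inject₁ i≡j))
          ∷ y! ,
        s≤s p≤∣y∣ , refl)

-- Distinct strings

allStrings-suc : ∀ σ n → allStrings σ (suc n) ≡ cartesianProductWith _∷_ (allFin σ) (allStrings σ n)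
allStrings-suc σ n = go (allFin σ)
  where
  go : ∀ cs → concatMap (λ c → map (c ∷_) (allStrings σ n)) cs ≡ cartesianProductWith _∷_ cs (allStrings σ n)
  go [] = refl
  go (c ∷ cs) = cong (map (c ∷_) (allStrings σ n) ++_) (go cs)

∈-allStrings⁻ : ∀ σ n {x} → x ∈ allStrings σ n → length x ≡ n
∈-allStrings⁻ σ zero (here refl) = refl
∈-allStrings⁻ σ (suc n) x∈ with ∈-cartesianProductWith⁻ _∷_ (allFin σ) _ (subst (_ ∈_) (allStrings-suc σ n) x∈)
... | c , y , _ , y∈ , refl = cong suc (∈-allStrings⁻ σ n y∈)

∈-allStrings⁺ : ∀ {σ} (x : Str σ) → x ∈ allStrings σ (length x)
∈-allStrings⁺ [] = here refl
∈-allStrings⁺ {σ} (c ∷ x) =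
  subst (_ ∈_) (sym (allStrings-suc σ (length x))) (∈-cartesianProductWith⁺ _∷_ (∈-allFin c) (∈-allStrings⁺ x))

allStrings-unique : ∀ σ n → Unique (allStrings σ n)
allStrings-unique σ zero = [] ∷ []
allStrings-unique σ (suc n) = subst Unique (sym (allStrings-suc σ n))
  (Uniqueₚ.cartesianProductWith⁺ _∷_ ∷-injective (Uniqueₚ.allFin⁺ σ) (allStrings-unique σ n))

∈-distinctStrings⁻ : ∀ σ b {x} → x ∈ distinctStrings σ b → length x ≡ b × Unique x
∈-distinctStrings⁻ σ b x∈ with ∈-filter⁻ (unique? _≟ᶠ_) {xs = allStrings σ b} x∈
... | x∈all , x! = ∈-allStrings⁻ σ b x∈all , x!

∈-distinctStrings⁺ : ∀ {σ b} {x : Str σ} → length x ≡ b → Unique x → x ∈ distinctStrings σ b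
∈-distinctStrings⁺ refl x! = ∈-filter⁺ (unique? _≟ᶠ_) (∈-allStrings⁺ _) x!

distinctStrings-unique : ∀ σ b → Unique (distinctStrings σ b)
distinctStrings-unique σ b = Uniqueₚ.filter⁺ (unique? _≟ᶠ_) (allStrings-unique σ b)

distinctStrings-nonempty : ∀ {σ b} → b ≤ σ → 0 < length (distinctStrings σ b)
distinctStrings-nonempty {σ} {b} b≤σ = ∈-length (∈-distinctStrings⁺ ∣first-b∣ (Uniqueₚ.take⁺ b (Uniqueₚ.allFin⁺ σ)))
  where
  ∣first-b∣ : length (take b (allFin σ)) ≡ b
  ∣first-b∣ = trans (length-take b (allFin σ)) (trans (cong (b ⊓_) (length-tabulate {n = σ} id)) (m≤n⇒m⊓n≡m b≤σ))

distinctStrings-suc : ∀ σ b →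
  distinctStrings (suc σ) (suc b) ↭ map lift (distinctStrings σ (suc b)) ++ topInsertions (distinctStrings σ b) (suc b)
distinctStrings-suc σ b =
  ∼bag⇒↭ (unique∧set⇒bag (distinctStrings-unique (suc σ) (suc b)) split-unique (mk⇔ to from))
  where
  D₀ D₁ : List (Str σ)
  D₀ = distinctStrings σ b
  D₁ = distinctStrings σ (suc b)
  split : List (Str (suc σ))
  split = map lift D₁ ++ topInsertions D₀ (suc b)

  to : ∀ {x} → x ∈ distinctStrings (suc σ) (suc b) → x ∈ split
  to x∈ with ∈-distinctStrings⁻ (suc σ) (suc b) x∈
  ... | ∣x∣≡1+b , x! with liftOrInsertTop _ x!
  ...   | inj₁ (y , y! , refl) =
    ∈-++⁺ˡ (∈-map⁺ lift (∈-distinctStrings⁺ (trans (sym (length-map inject₁ y)) ∣x∣≡1+b) y!))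
  ...   | inj₂ (p , y , y! , p≤∣y∣ , refl) =
    ∈-++⁺ʳ (map lift D₁) (∈-topInsertions⁺ D₀ (suc b) (s≤s (subst (p ≤_) ∣y∣≡b p≤∣y∣)) (∈-distinctStrings⁺ ∣y∣≡b y!))
    where
    ∣y∣≡b : length y ≡ b
    ∣y∣≡b = suc-injective (trans (sym (length-insertTop p y)) ∣x∣≡1+b)

  from : ∀ {x} → x ∈ split → x ∈ distinctStrings (suc σ) (suc b)
  from x∈ with ∈-++⁻ (map lift D₁) x∈
  ... | inj₁ x∈lifts with ∈-map⁻ lift x∈lifts
  ...   | y , y∈D₁ , refl with ∈-distinctStrings⁻ σ (suc b) y∈D₁
  ...     | ∣y∣≡1+b , y! = ∈-distinctStrings⁺ (trans (length-map inject₁ y) ∣y∣≡1+b) (lift-unique y!)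
  from x∈ | inj₂ x∈tops with ∈-topInsertions⁻ D₀ (suc b) x∈tops
  ...   | p , y , _ , y∈D₀ , refl with ∈-distinctStrings⁻ σ b y∈D₀
  ...     | ∣y∣≡b , y! =
    ∈-distinctStrings⁺ (trans (length-insertTop p y) (cong suc ∣y∣≡b)) (insert-unique p _ (fromℕ∉lift y) (lift-unique y!))

  split-unique : Unique split
  split-unique = Uniqueₚ.++⁺ (Uniqueₚ.map⁺ lift-injective (distinctStrings-unique σ (suc b)))
    (topInsertions-unique D₀ (suc b) (proj₁ ∘ ∈-distinctStrings⁻ σ b) ≤-refl (distinctStrings-unique σ b))
    disjoint
    where
    disjoint : Disjoint (map lift D₁) (topInsertions D₀ (suc b))
    disjoint (x∈lifts , x∈tops) with ∈-map⁻ lift x∈lifts | ∈-topInsertions⁻ D₀ (suc b) x∈tops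
    ... | y , _ , refl | p , y′ , _ , _ , eq = fromℕ∉lift y (subst (fromℕ σ ∈_) (sym eq) (∈-insert p _ (lift y′)))

-- Strings sharing a pattern

length-filter-map-≤ : {A B : Set} {P : B → Set} {Q : A → Set} (P? : Decidable P) (Q? : Decidable Q)
  (f : A → B) (xs : List A) → (∀ {x} → x ∈ xs → P (f x) → Q x) →
  length (filter P? (map f xs)) ≤ length (filter Q? xs)
length-filter-map-≤ P? Q? f [] _ = z≤n
length-filter-map-≤ P? Q? f (x ∷ xs) P⇒Q with P? (f x) | Q? x
... | yes Pfx | yes _ = s≤s (length-filter-map-≤ P? Q? f xs (P⇒Q ∘ there))
... | yes Pfx | no ¬Qx = ⊥-elim (¬Qx (P⇒Q (here refl) Pfx))
... | no _ | yes _ = m≤n⇒m≤1+n (length-filter-map-≤ P? Q? f xs (P⇒Q ∘ there))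
... | no _ | no _ = length-filter-map-≤ P? Q? f xs (P⇒Q ∘ there)

hasPre? : ∀ {σ} (π : List ℕ) → Decidable (λ (x : Str σ) → Pre x ≡ π)
hasPre? π x = ≡-dec _≟_ (Pre x) π

countPre : ∀ {σ} → List ℕ → List (Str σ) → ℕ
countPre π xs = length (filter (hasPre? π) xs)

countPre-++ : ∀ {σ} π (xs ys : List (Str σ)) → countPre π (xs ++ ys) ≡ countPre π xs + countPre π ys
countPre-++ π xs ys = trans (cong length (filter-++ (hasPre? π) xs ys)) (length-++ (filter (hasPre? π) xs))

module _ {σ b : ℕ} (ys : List (Str σ)) (∣ys∣≡b : ∀ {y} → y ∈ ys → length y ≡ b) where

  private
    ≤length : ∀ {p y} → p ≤ b → y ∈ ys → p ≤ length y
    ≤length p≤b y∈ys = subst (_ ≤_) (sym (∣ys∣≡b y∈ys)) p≤b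

  countPre-topInsertions-earlier : ∀ {n y₀} → n ≤ b → y₀ ∈ ys →
    countPre (Pre (insertTop n y₀)) (topInsertions ys n) ≡ 0
  countPre-topInsertions-earlier {n} {y₀} n≤b y₀∈ys = cong length (filter-none (hasPre? _) (All.tabulate miss))
    where
    miss : ∀ {x} → x ∈ topInsertions ys n → Pre x ≢ Pre (insertTop n y₀)
    miss x∈ Pre≡ with ∈-topInsertions⁻ ys n x∈
    ... | p , y , p<n , y∈ys , refl =
      <-irrefl (proj₁ (Pre-insertTop-injective (≤length (≤-trans (<⇒≤ p<n) n≤b) y∈ys) (≤length n≤b y₀∈ys) Pre≡)) p<n

  countPre-insertTop-≤ : ∀ {n y₀} → n ≤ b → y₀ ∈ ys →
    countPre (Pre (insertTop n y₀)) (map (insertTop n) ys) ≤ countPre (Pre y₀) ys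
  countPre-insertTop-≤ {n} n≤b y₀∈ys = length-filter-map-≤ (hasPre? _) (hasPre? _) (insertTop n) ys
    λ y∈ys Pre≡ → proj₂ (Pre-insertTop-injective (≤length n≤b y∈ys) (≤length n≤b y₀∈ys) Pre≡)

  countPre-topInsertions : (∀ π → b ! * countPre π ys ≤ length ys) →
    ∀ π n → n ≤ suc b → b ! * countPre π (topInsertions ys n) ≤ length ys
  countPre-topInsertions ys-bound π zero _ = ≤-trans (≤-reflexive (*-zeroʳ (b !))) z≤n
  countPre-topInsertions ys-bound π (suc n) (s≤s n≤b) with any? (hasPre? π) (map (insertTop n) ys)
  ... | no none = begin
    b ! * countPre π (earlier ++ latest)             ≡⟨ cong (b ! *_) (countPre-++ π earlier latest) ⟩
    b ! * (countPre π earlier + countPre π latest)   ≡⟨ cong (λ c → b ! * (countPre π earlier + length c))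
                                                             (filter-none (hasPre? π) (¬Any⇒All¬ latest none)) ⟩
    b ! * (countPre π earlier + 0)                   ≡⟨ cong (b ! *_) (+-identityʳ _) ⟩
    b ! * countPre π earlier                         ≤⟨ countPre-topInsertions ys-bound π n (m≤n⇒m≤1+n n≤b) ⟩
    length ys                                        ∎
    where
    open ≤-Reasoning
    earlier latest : List (Str (suc σ))
    earlier = topInsertions ys n
    latest = map (insertTop n) ys
  ... | yes some with find (map⁻ some)
  ...   | y₀ , y₀∈ys , refl = begin
    b ! * countPre π (earlier ++ latest)             ≡⟨ cong (b ! *_) (countPre-++ π earlier latest) ⟩
    b ! * (countPre π earlier + countPre π latest)   ≡⟨ cong (λ c → b ! * (c + countPre π latest))
                                                             (countPre-topInsertions-earlier n≤b y₀∈ys) ⟩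
    b ! * countPre π latest                          ≤⟨ *-monoʳ-≤ (b !) (countPre-insertTop-≤ n≤b y₀∈ys) ⟩
    b ! * countPre (Pre y₀) ys                       ≤⟨ ys-bound (Pre y₀) ⟩
    length ys                                        ∎
    where
    open ≤-Reasoning
    earlier latest : List (Str (suc σ))
    earlier = topInsertions ys n
    latest = map (insertTop n) ys

countPre-distinctStrings : ∀ σ b π → b ! * countPre π (distinctStrings σ b) ≤ length (distinctStrings σ b)
countPre-distinctStrings σ zero π =
  ≤-trans (≤-reflexive (+-identityʳ _)) (length-filter (hasPre? π) (distinctStrings σ zero))
countPre-distinctStrings zero (suc b) π = ≤-reflexive (*-zeroʳ (suc b !))
countPre-distinctStrings (suc σ) (suc b) π = begin
  suc b ! * countPre π D                              ≡⟨ cong (λ c → suc b ! * c) (↭-length (filter-↭ (hasPre? π) D↭)) ⟩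
  suc b ! * countPre π (lifts ++ tops)                ≡⟨ cong (suc b ! *_) (countPre-++ π lifts tops) ⟩
  suc b ! * (countPre π lifts + countPre π tops)      ≡⟨ *-distribˡ-+ (suc b !) (countPre π lifts) _ ⟩
  suc b ! * countPre π lifts + suc b ! * countPre π tops ≤⟨ +-mono-≤ lifts-bound tops-bound ⟩
  length D₁ + suc b * length D₀                       ≡⟨ cong₂ _+_ (sym (length-map lift D₁)) (sym (length-topInsertions D₀ (suc b))) ⟩
  length lifts + length tops                          ≡⟨ length-++ lifts ⟨
  length (lifts ++ tops)                              ≡⟨ ↭-length D↭ ⟨
  length D                                            ∎
  where
  open ≤-Reasoning
  D₀ D₁ : List (Str σ)
  D₀ = distinctStrings σ b
  D₁ = distinctStrings σ (suc b)
  D lifts tops : List (Str (suc σ))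
  D = distinctStrings (suc σ) (suc b)
  lifts = map lift D₁
  tops = topInsertions D₀ (suc b)
  D↭ : D ↭ lifts ++ tops
  D↭ = distinctStrings-suc σ b
  lifts-bound : suc b ! * countPre π lifts ≤ length D₁
  lifts-bound = ≤-trans
    (*-monoʳ-≤ (suc b !) (length-filter-map-≤ (hasPre? π) (hasPre? π) lift D₁ λ {y} _ → trans (sym (Pre-lift y))))
    (countPre-distinctStrings σ (suc b) π)
  tops-bound : suc b ! * countPre π tops ≤ suc b * length D₀
  tops-bound = ≤-trans (≤-reflexive (*-assoc (suc b) (b !) _))
    (*-monoʳ-≤ (suc b) (countPre-topInsertions D₀ (proj₁ ∘ ∈-distinctStrings⁻ σ b) (countPre-distinctStrings σ b) π
                                               (suc b) ≤-refl))

-- Shifts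

maxList-∈ : (xs : List ℕ) {l : ℕ} → maxList xs ≡ just l → l ∈ xs
maxList-∈ (j ∷ js) eq with maxList js in eq′
maxList-∈ (j ∷ js) refl | nothing = here refl
maxList-∈ (j ∷ js) refl | just l with ⊔-sel j l
... | inj₁ j⊔l≡j = here j⊔l≡j
... | inj₂ j⊔l≡l = there (subst (_∈ js) (sym j⊔l≡l) (maxList-∈ js eq′))

shift-plus-weight : ∀ {b l m} → b ≤ l → l ≤ m → (m ∸ l) ⊓ suc (m ∸ b) + (suc l ∸ b) ≡ suc (m ∸ b)
shift-plus-weight {b} {l} {m} b≤l l≤m = begin
  (m ∸ l) ⊓ suc (m ∸ b) + (suc l ∸ b) ≡⟨ cong (_+ (suc l ∸ b)) (m≤n⇒m⊓n≡m (m≤n⇒m≤1+n (∸-monoʳ-≤ m b≤l))) ⟩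
  (m ∸ l) + (suc l ∸ b)              ≡⟨ cong ((m ∸ l) +_) (+-∸-assoc 1 b≤l) ⟩
  (m ∸ l) + suc (l ∸ b)              ≡⟨ +-suc (m ∸ l) (l ∸ b) ⟩
  suc ((m ∸ l) + (l ∸ b))            ≡⟨ cong suc (+-∸-assoc (m ∸ l) b≤l) ⟨
  suc ((m ∸ l + l) ∸ b)              ≡⟨ cong (λ n → suc (n ∸ b)) (m∸n+n≡m l≤m) ⟩
  suc (m ∸ b)                        ∎
  where open ≡-Reasoning

∈-range⁻ : ∀ {b m l} → b ≤ m → l ∈ range b m → b ≤ l × l ≤ m
∈-range⁻ {b} {m} b≤m l∈ with ∈-map⁻ (b +_) l∈
... | t , t∈ , refl = m≤m+n b t , ≤-pred (subst (b + t <_) (m+[n∸m]≡n (m≤n⇒m≤1+n b≤m)) (+-monoʳ-< b (∈-upTo⁻ t∈)))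

module _ {σ k m b : ℕ} (P : Fin k → Str σ) where

  window : Fin k → ℕ → Str σ
  window i j = substr (P i) (suc j ∸ b) j

  weight : ℕ → ℕ
  weight j = suc j ∸ b

  hit : ℕ → Fin k → Str σ → ℕ
  hit j i x = if does (hasPre? (Pre (window i j)) x) then weight j else 0

  deficit : Str σ → ℕ
  deficit x = sum (map (λ j → sum (map (λ i → hit j i x) (allFin k))) (range b m))

  shift+deficit : b ≤ m → ∀ x → suc (m ∸ b) ≤ shift k m b P x + deficit x
  shift+deficit b≤m x with lx k m b P x in lx≡
  ... | nothing = m≤m+n (suc (m ∸ b)) (deficit x)
  ... | just l with ∈-filter⁻ _ {xs = range b m} (maxList-∈ _ lx≡)
  ...   | l∈range , some-window with satisfied some-window | ∈-range⁻ b≤m l∈range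
  ...     | i , Pre≡ | b≤l , l≤m = begin
    suc (m ∸ b)                                     ≡⟨ shift-plus-weight b≤l l≤m ⟨
    (m ∸ l) ⊓ suc (m ∸ b) + weight l               ≤⟨ +-monoʳ-≤ ((m ∸ l) ⊓ suc (m ∸ b)) weight≤deficit ⟩
    (m ∸ l) ⊓ suc (m ∸ b) + deficit x              ∎
    where
    open ≤-Reasoning
    hit≡weight : hit l i x ≡ weight l
    hit≡weight rewrite dec-true (hasPre? (Pre (window i l)) x) (sym Pre≡) = refl
    weight≤deficit : weight l ≤ deficit x
    weight≤deficit = begin
      weight l                                    ≡⟨ hit≡weight ⟨
      hit l i x                                   ≤⟨ ∈⇒≤sum-map (λ i → hit l i x) (∈-allFin i) ⟩
      sum (map (λ i → hit l i x) (allFin k))      ≤⟨ ∈⇒≤sum-map (λ j → sum (map (λ i → hit j i x) (allFin k))) l∈range ⟩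
      deficit x                                   ∎

  sum-deficit : (xs : List (Str σ)) → sum (map deficit xs) ≡
    sum (map (λ j → sum (map (λ i → weight j * countPre (Pre (window i j)) xs) (allFin k))) (range b m))
  sum-deficit xs = begin
    sum (map deficit xs)
      ≡⟨ sum-map-comm (λ x j → sum (map (λ i → hit j i x) (allFin k))) xs (range b m) ⟩
    sum (map (λ j → sum (map (λ x → sum (map (λ i → hit j i x) (allFin k))) xs)) (range b m))
      ≡⟨ cong sum (map-cong (λ j → sum-map-comm (λ x i → hit j i x) xs (allFin k)) (range b m)) ⟩
    sum (map (λ j → sum (map (λ i → sum (map (hit j i) xs)) (allFin k))) (range b m))
      ≡⟨ cong sum (map-cong (λ j → cong sum (map-cong (λ i → sum-map-if (hasPre? (Pre (window i j))) (weight j) xs)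
                                                      (allFin k)))
                            (range b m)) ⟩
    sum (map (λ j → sum (map (λ i → weight j * countPre (Pre (window i j)) xs) (allFin k))) (range b m)) ∎
    where open ≡-Reasoning

  deficit-bound : (xs : List (Str σ)) → (∀ π → b ! * countPre π xs ≤ length xs) →
    b ! * sum (map deficit xs) ≤ k * (length xs * sum (map weight (range b m)))
  deficit-bound xs xs-bound = begin
    b ! * sum (map deficit xs)
      ≡⟨ cong (b ! *_) (sum-deficit xs) ⟩
    b ! * sum (map (λ j → sum (map (λ i → weight j * c i j) (allFin k))) (range b m))
      ≡⟨ sum-map-*ˡ (b !) _ (range b m) ⟨
    sum (map (λ j → b ! * sum (map (λ i → weight j * c i j) (allFin k))) (range b m))
      ≤⟨ sum-map-mono (range b m) per-end ⟩
    sum (map (λ j → k * (N * weight j)) (range b m))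
      ≡⟨ sum-map-*ˡ k (λ j → N * weight j) (range b m) ⟩
    k * sum (map (λ j → N * weight j) (range b m))
      ≡⟨ cong (k *_) (sum-map-*ˡ N weight (range b m)) ⟩
    k * (N * sum (map weight (range b m)))   ∎
    where
    open ≤-Reasoning
    N : ℕ
    N = length xs
    c : Fin k → ℕ → ℕ
    c i j = countPre (Pre (window i j)) xs
    per-end : ∀ j → b ! * sum (map (λ i → weight j * c i j) (allFin k)) ≤ k * (N * weight j)
    per-end j = begin
      b ! * sum (map (λ i → weight j * c i j) (allFin k))  ≡⟨ sum-map-*ˡ (b !) _ (allFin k) ⟨
      sum (map (λ i → b ! * (weight j * c i j)) (allFin k)) ≤⟨ sum-map-mono (allFin k) per-window ⟩
      sum (map (λ _ → N * weight j) (allFin k))             ≡⟨ sum-map-const (N * weight j) (allFin k) ⟩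
      length (allFin k) * (N * weight j)                    ≡⟨ cong (_* (N * weight j)) (length-tabulate {n = k} id) ⟩
      k * (N * weight j)                                    ∎
      where
      per-window : ∀ i → b ! * (weight j * c i j) ≤ N * weight j
      per-window i = begin
        b ! * (weight j * c i j)  ≡⟨ x∙yz≈y∙xz (b !) (weight j) (c i j) ⟩
        weight j * (b ! * c i j)  ≤⟨ *-monoʳ-≤ (weight j) (xs-bound _) ⟩
        weight j * N              ≡⟨ *-comm (weight j) N ⟩
        N * weight j              ∎

  2*sum-weight : b ≤ m → 2 * sum (map weight (range b m)) ≡ suc (m ∸ b) * suc (suc (m ∸ b))
  2*sum-weight b≤m = begin
    2 * sum (map weight (range b m))                      ≡⟨ cong (λ ws → 2 * sum ws) weights ⟩
    2 * sum (map suc (upTo (suc m ∸ b)))                  ≡⟨ cong (λ n → 2 * sum (map suc (upTo n))) (+-∸-assoc 1 b≤m) ⟩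
    2 * sum (map suc (upTo (suc (m ∸ b))))                ≡⟨ 2*sum-upTo-suc (suc (m ∸ b)) ⟩
    suc (m ∸ b) * suc (suc (m ∸ b))                       ∎
    where
    open ≡-Reasoning
    weights : map weight (range b m) ≡ map suc (upTo (suc m ∸ b))
    weights = trans (sym (map-∘ (upTo (suc m ∸ b))))
      (map-cong (λ t → trans (cong (_∸ b) (sym (+-suc b t))) (m+n∸m≡n b (suc t))) (upTo (suc m ∸ b)))

  shift-sum-bound : b ≤ m → (xs : List (Str σ)) → (∀ π → b ! * countPre π xs ≤ length xs) →
    let M = suc (m ∸ b); N = length xs in
    2 * b ! * N * M ≤ 2 * b ! * sum (map (shift k m b P) xs) + k * suc M * N * M
  shift-sum-bound b≤m xs xs-bound = begin
    2 * b ! * N * M                         ≡⟨ *-assoc (2 * b !) N M ⟩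
    2 * b ! * (N * M)                       ≡⟨ cong (2 * b ! *_) (sum-map-const M xs) ⟨
    2 * b ! * sum (map (λ _ → M) xs)        ≤⟨ *-monoʳ-≤ (2 * b !) (sum-map-mono xs (shift+deficit b≤m)) ⟩
    2 * b ! * sum (map (λ x → S x + deficit x) xs)  ≡⟨ cong (2 * b ! *_) (sum-map-+ S deficit xs) ⟩
    2 * b ! * (ΣS + ΣD)                     ≡⟨ split (b !) ΣS ΣD ⟩
    2 * b ! * ΣS + 2 * (b ! * ΣD)           ≤⟨ +-monoʳ-≤ (2 * b ! * ΣS) (*-monoʳ-≤ 2 (deficit-bound xs xs-bound)) ⟩
    2 * b ! * ΣS + 2 * (k * (N * ΣW))       ≡⟨ cong (2 * b ! * ΣS +_) (regroup k N ΣW) ⟩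
    2 * b ! * ΣS + k * N * (2 * ΣW)         ≡⟨ cong (λ w → 2 * b ! * ΣS + k * N * w) (2*sum-weight b≤m) ⟩
    2 * b ! * ΣS + k * N * (M * suc M)      ≡⟨ cong (2 * b ! * ΣS +_) (regroup′ k N M) ⟩
    2 * b ! * ΣS + k * suc M * N * M        ∎
    where
    open ≤-Reasoning
    S : Str σ → ℕ
    S = shift k m b P
    M N ΣS ΣD ΣW : ℕ
    M = suc (m ∸ b)
    N = length xs
    ΣS = sum (map S xs)
    ΣD = sum (map deficit xs)
    ΣW = sum (map weight (range b m))
    split : ∀ f s d → 2 * f * (s + d) ≡ 2 * f * s + 2 * (f * d)
    split = solve-∀
    regroup : ∀ k n w → 2 * (k * (n * w)) ≡ k * n * (2 * w)
    regroup = solve-∀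
    regroup′ : ∀ k n M → k * n * (M * suc M) ≡ k * suc M * n * M
    regroup′ = solve-∀

-- Clearing denominators

module _ where
  open import Data.Integer using (+_)

  cross-multiplied : ∀ M a D S N → D ℕ.* N ℕ.* M ℕ.≤ D ℕ.* S ℕ.+ a ℕ.* N ℕ.* M →
    (+ M ℤ.* (+ 1 ℤ.* + D ℤ.+ ℤ.- (+ a) ℤ.* + 1)) ℤ.* + N ℤ.≤ + S ℤ.* + (1 ℕ.* (1 ℕ.* D))
  cross-multiplied M a D S N h = begin
    (+ M ℤ.* (+ 1 ℤ.* + D ℤ.+ ℤ.- (+ a) ℤ.* + 1)) ℤ.* + N  ≡⟨ expand (+ M) (+ a) (+ D) (+ N) ⟩
    + D ℤ.* + N ℤ.* + M ℤ.- + a ℤ.* + N ℤ.* + M          ≤⟨ ℤₚ.+-monoˡ-≤ (ℤ.- (+ a ℤ.* + N ℤ.* + M)) h′ ⟩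
    + D ℤ.* + S ℤ.+ + a ℤ.* + N ℤ.* + M ℤ.- + a ℤ.* + N ℤ.* + M ≡⟨ cancel (+ D ℤ.* + S) (+ a ℤ.* + N ℤ.* + M) ⟩
    + D ℤ.* + S                                          ≡⟨ ℤₚ.*-comm (+ D) (+ S) ⟩
    + S ℤ.* + D                                          ≡⟨ cong (λ d → + S ℤ.* + d) (trans (*-identityˡ _) (*-identityˡ D)) ⟨
    + S ℤ.* + (1 ℕ.* (1 ℕ.* D))                          ∎
    where
    open ℤₚ.≤-Reasoning
    expand : ∀ m a d n → (m ℤ.* (+ 1 ℤ.* d ℤ.+ ℤ.- a ℤ.* + 1)) ℤ.* n ≡ d ℤ.* n ℤ.* m ℤ.- a ℤ.* n ℤ.* m
    expand = solve-∀ℤ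
    cancel : ∀ x y → x ℤ.+ y ℤ.- y ≡ x
    cancel = solve-∀ℤ
    h′ : + D ℤ.* + N ℤ.* + M ℤ.≤ + D ℤ.* + S ℤ.+ + a ℤ.* + N ℤ.* + M
    h′ = subst₂ ℤ._≤_
      (trans (ℤₚ.pos-* (D ℕ.* N) M) (cong (ℤ._* + M) (ℤₚ.pos-* D N)))
      (trans (ℤₚ.pos-+ (D ℕ.* S) (a ℕ.* N ℕ.* M))
             (cong₂ ℤ._+_ (ℤₚ.pos-* D S) (trans (ℤₚ.pos-* (a ℕ.* N) M) (cong (ℤ._* + M) (ℤₚ.pos-* a N)))))
      (ℤ.+≤+ h)

  toℚᵘ-/ : ∀ (i : ℤ) n .{{_ : NonZero n}} → toℚᵘ (i / n) ℚᵘ.≃ (i ℚᵘ./ n)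
  toℚᵘ-/ i (suc n) = ℚₚ.toℚᵘ-fromℚᵘ (ℚᵘ.mkℚᵘ i n)

  scaled-difference≤ratio : ∀ (M a D S N : ℕ) .{{_ : NonZero D}} .{{_ : NonZero N}} →
    D ℕ.* N ℕ.* M ℕ.≤ D ℕ.* S ℕ.+ a ℕ.* N ℕ.* M →
    (+ M / 1) ℚ.* (1ℚ ℚ.- (+ a) / D) ℚ.≤ (+ S) / N
  scaled-difference≤ratio M a D@(suc _) S N@(suc _) h =
    ℚₚ.toℚᵘ-cancel-≤ (ℚᵘₚ.≤-respʳ-≃ (ℚᵘₚ.≃-sym (toℚᵘ-/ (+ S) N))
                      (ℚᵘₚ.≤-respˡ-≃ (ℚᵘₚ.≃-sym lhs≃) (ℚᵘ.*≤* (cross-multiplied M a D S N h))))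
    where
    lhs≃ : toℚᵘ ((+ M / 1) ℚ.* (1ℚ ℚ.- (+ a) / D)) ℚᵘ.≃ (+ M ℚᵘ./ 1) ℚᵘ.* ((+ 1 ℚᵘ./ 1) ℚᵘ.+ ℚᵘ.- (+ a ℚᵘ./ D))
    lhs≃ = ℚᵘₚ.≃-trans (ℚₚ.toℚᵘ-homo-* (+ M / 1) (1ℚ ℚ.- (+ a) / D))
      (ℚᵘₚ.*-cong (toℚᵘ-/ (+ M) 1)
        (ℚᵘₚ.≃-trans (ℚₚ.toℚᵘ-homo-+ 1ℚ (ℚ.- ((+ a) / D)))
          (ℚᵘₚ.+-cong (toℚᵘ-/ (+ 1) 1)
            (ℚᵘₚ.≃-trans (ℚₚ.toℚᵘ-homo‿- ((+ a) / D)) (ℚᵘₚ.-‿cong (toℚᵘ-/ (+ a) D))))))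

average-suc : ∀ (xs : List ℕ) n → length xs ≡ suc n → average xs ≡ (ℤ.+ sum xs) / suc n
average-suc xs n ∣xs∣≡ with length xs
average-suc xs n refl | .(suc n) = refl

lemma5 : (σ k m b : ℕ) (P : Fin k → Str σ) →
    (∀ i → length (P i) ≡ m) →
    1 ≤ b → b ≤ m → b ≤ σ →
    (∀ i j → b ≤ j → j ≤ m → Unique (substr (P i) (suc j ∸ b) j)) →
    expectedShift σ k m b P ≥ bound k m b
lemma5 σ k m b P _ _ b≤m b≤σ _ with length (distinctStrings σ b) in ∣D∣≡ | distinctStrings-nonempty {σ} {b} b≤σ
... | suc n | _ =
  subst (bound k m b ℚ.≤_) (sym (average-suc (map S D) n (trans (length-map S D) ∣D∣≡)))
    (scaled-difference≤ratio M (k * suc M) (2 * b !) (sum (map S D)) (suc n) {{m*n≢0 2 (b !) {{_}} {{b !≢0}}}}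
      (subst (λ N → 2 * b ! * N * M ≤ 2 * b ! * sum (map S D) + k * suc M * N * M) ∣D∣≡
        (shift-sum-bound P b≤m D (countPre-distinctStrings σ b))))
  where
  D : List (Str σ)
  D = distinctStrings σ b
  M : ℕ
  M = suc (m ∸ b)
  S : Str σ → ℕ
  S = shift k m b P
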